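{- Let $K$ be a field of characteristic zero, ${\bf x}=(x_1,x_2,\ldots)$ a finite or infinite sequence of variables, and $\{b_{\bf n}({\bf x})\}$ (indexed by finitely supported sequences ${\bf n}$ of nonnegative integers) a basis of $K[{\bf x}]$ with $b_{\bf n}({\bf 0})=\delta_{{\bf n},{\bf 0}}$. Let $B_i$ be the linear operator with $B_i b_{\bf n}=b_{{\bf n}-e_i}$ (with $b_{\bf m}:=0$ if ${\bf m}$ has a negative entry). If polynomials $a_{\bf n}({\bf x})\in K[{\bf x}]$ satisfy $\sum_{\bf n} a_{\bf n}({\bf X})\,{\bf B}^{\bf n}=0$ as an operator on $K[{\bf x}]$, then $a_{\bf n}=0$ for all ${\bf n}$. Consequently the expansion of a linear operator $Q$ on $K[{\bf x}]$ in the form $Q=\sum_{\bf n} a_{\bf n}({\bf X})\,{\bf B}^{\bf n}$ with polynomial coefficients is unique.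
   Context: $e_i$ is the $i$-th unit vector, ${\bf B}^{\bf n}=B_1^{n_1}B_2^{n_2}\cdots$, and $a({\bf X})$ denotes multiplication by the polynomial $a({\bf x})$. Infinite sums of operators are understood pointwise on polynomials (only finitely many terms are nonzero on any given polynomial). -}

module Defs where

open import Level using (Level; _⊔_)
open import Data.Nat as ℕ using (ℕ; zero; suc)
open import Data.Fin using (Fin)
open import Data.Vec as Vec using (Vec)
import Data.Vec.Properties as VecP
open import Data.List as List using (List; []; _∷_; _++_)
open import Data.List.Relation.Unary.Unique.Propositional using (Unique)
open import Data.List.Membership.Propositional using (_∉_)
open import Data.Maybe using (Maybe; just; nothing)
import Data.Maybe as Maybe
open import Data.Product using (Σ; ∃; _×_; _,_)
open import Data.Empty using (⊥)
open import Relation.Nullary using (¬_; Dec; yes; no)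
open import Relation.Binary.PropositionalEquality using (_≡_; refl; cong; cong₂)
open import Relation.Binary.Definitions using (DecidableEquality)
open import Algebra.Bundles using (CommutativeRing)

module _ {c ℓ} (K : CommutativeRing c ℓ) where
  open CommutativeRing K

  natK : ℕ → Carrier
  natK zero    = 0#
  natK (suc n) = 1# + natK n

  IsField : Set (c ⊔ ℓ)
  IsField = (¬ (1# ≈ 0#)) × (∀ x → ¬ (x ≈ 0#) → ∃ λ y → (x * y) ≈ 1#)

  CharZero : Set ℓ
  CharZero = ∀ n → natK n ≈ 0# → n ≡ 0

data VarSpec : Set where
  finite   : ℕ → VarSpec
  infinite : VarSpec

Var : VarSpec → Set
Var (finite d) = Fin d
Var infinite   = ℕ

-- Canonical finitely supported sequences ℕ → ℕ that are not identically 0: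
-- a list of exponents whose last entry is nonzero;  (last k) is the entry suc k.
data Pos : Set where
  last : ℕ → Pos
  _∷ₚ_ : ℕ → Pos → Pos

data Seq : Set where
  zeroₛ : Seq
  pos   : Pos → Seq

consₛ : ℕ → Seq → Seq
consₛ zero    zeroₛ   = zeroₛ
consₛ (suc k) zeroₛ   = pos (last k)
consₛ x       (pos p) = pos (x ∷ₚ p)

addₚ : Pos → Pos → Pos
addₚ (last a)  (last b)  = last (suc (a ℕ.+ b))
addₚ (last a)  (y ∷ₚ q)  = (suc a ℕ.+ y) ∷ₚ q
addₚ (x ∷ₚ p)  (last b)  = (x ℕ.+ suc b) ∷ₚ p
addₚ (x ∷ₚ p)  (y ∷ₚ q)  = (x ℕ.+ y) ∷ₚ addₚ p q

decₚ : ℕ → Pos → Maybe Seq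
decₚ zero    (last k)        = just (consₛ k zeroₛ)
decₚ zero    (zero ∷ₚ p)     = nothing
decₚ zero    (suc x ∷ₚ p)    = just (pos (x ∷ₚ p))
decₚ (suc i) (last k)        = nothing
decₚ (suc i) (x ∷ₚ p)        = Maybe.map (consₛ x) (decₚ i p)

varsₚ : ℕ → Pos → List ℕ
varsₚ i (last k) = List.replicate (suc k) i
varsₚ i (x ∷ₚ p) = List.replicate x i ++ varsₚ (suc i) p

last-inj : ∀ {a b} → last a ≡ last b → a ≡ b
last-inj refl = refl

∷ₚ-injˡ : ∀ {a b p q} → (a ∷ₚ p) ≡ (b ∷ₚ q) → a ≡ b
∷ₚ-injˡ refl = refl

∷ₚ-injʳ : ∀ {a b p q} → (a ∷ₚ p) ≡ (b ∷ₚ q) → p ≡ q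
∷ₚ-injʳ refl = refl

_≟ₚ_ : DecidableEquality Pos
last a ≟ₚ last b with a ℕ.≟ b
... | yes refl = yes refl
... | no ne    = no λ e → ne (last-inj e)
last a ≟ₚ (y ∷ₚ q) = no λ ()
(x ∷ₚ p) ≟ₚ last b = no λ ()
(x ∷ₚ p) ≟ₚ (y ∷ₚ q) with x ℕ.≟ y | p ≟ₚ q
... | yes refl | yes refl = yes refl
... | no ne    | _        = no λ e → ne (∷ₚ-injˡ e)
... | yes _    | no ne    = no λ e → ne (∷ₚ-injʳ e)

pos-inj : ∀ {p q} → pos p ≡ pos q → p ≡ q
pos-inj refl = refl

_≟ₛ_ : DecidableEquality Seq
zeroₛ ≟ₛ zeroₛ = yes refl
zeroₛ ≟ₛ pos q = no λ ()
pos p ≟ₛ zeroₛ = no λ ()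
pos p ≟ₛ pos q with p ≟ₚ q
... | yes refl = yes refl
... | no ne    = no λ e → ne (pos-inj e)

Mono : VarSpec → Set
Mono (finite d) = Vec ℕ d
Mono infinite   = Seq

mzero : ∀ vs → Mono vs
mzero (finite d) = Vec.replicate d 0
mzero infinite   = zeroₛ

madd : ∀ vs → Mono vs → Mono vs → Mono vs
madd (finite d) m n = Vec.zipWith ℕ._+_ m n
madd infinite zeroₛ   n       = n
madd infinite (pos p) zeroₛ   = pos p
madd infinite (pos p) (pos q) = pos (addₚ p q)

meq : ∀ vs → DecidableEquality (Mono vs)
meq (finite d) = VecP.≡-dec ℕ._≟_
meq infinite   = _≟ₛ_

-- n - e_i   (nothing when n has a zero i-th entry, i.e. n - e_i has a negative entry)
mdec : ∀ vs → Var vs → Mono vs → Maybe (Mono vs)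
mdec (finite d) i n with Vec.lookup n i
... | zero  = nothing
... | suc k = just (n Vec.[ i ]≔ k)
mdec infinite i zeroₛ   = nothing
mdec infinite i (pos p) = decₚ i p

mvars : ∀ vs → Mono vs → List (Var vs)
mvars (finite d) n = List.concatMap (λ i → List.replicate (Vec.lookup n i) i) (List.allFin d)
mvars infinite zeroₛ   = []
mvars infinite (pos p) = varsₚ 0 p

module PolyDefs {c ℓ} (K : CommutativeRing c ℓ) (vs : VarSpec) where
  open CommutativeRing K

  -- a polynomial is a finite formal K-linear combination of monomials x^n;
  -- two representations are identified iff all coefficients agree (_≈P_)
  Poly : Set c
  Poly = List (Carrier × Mono vs)

  coeff : Poly → Mono vs → Carrier
  coeff []             m = 0#
  coeff ((a , u) ∷ p)  m with meq vs u m
  ... | yes _ = a + coeff p m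
  ... | no  _ = coeff p m

  infix 4 _≈P_
  _≈P_ : Poly → Poly → Set ℓ
  p ≈P q = ∀ m → coeff p m ≈ coeff q m

  0P : Poly
  0P = []

  infixl 6 _+P_
  _+P_ : Poly → Poly → Poly
  p +P q = p ++ q

  _·P_ : Carrier → Poly → Poly
  a ·P p = List.map (λ { (b , u) → (a * b , u) }) p

  infixl 7 _*P_
  _*P_ : Poly → Poly → Poly
  p *P q = List.concatMap (λ { (a , u) → List.map (λ { (b , v) → (a * b , madd vs u v) }) q }) p

  sumP : List Poly → Poly
  sumP = List.foldr _+P_ 0P

  eval0 : Poly → Carrier
  eval0 p = coeff p (mzero vs)

  δ0 : Mono vs → Carrier
  δ0 n with meq vs n (mzero vs)
  ... | yes _ = 1#
  ... | no  _ = 0#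

  IsLinear : (Poly → Poly) → Set (c ⊔ ℓ)
  IsLinear T = (∀ p q → p ≈P q → T p ≈P T q)
             × (∀ p q → T (p +P q) ≈P T p +P T q)
             × (∀ a p → T (a ·P p) ≈P a ·P T p)

  combo : (Mono vs → Poly) → List (Carrier × Mono vs) → Poly
  combo b []             = 0P
  combo b ((a , n) ∷ l)  = a ·P b n +P combo b l

  -- {b_n} is a basis of K[x]: spanning and linearly independent
  -- (the coefficient of b_n in a formal combination l is  coeff l n)
  IsBasis : (Mono vs → Poly) → Set (c ⊔ ℓ)
  IsBasis b = (∀ p → ∃ λ (l : List (Carrier × Mono vs)) → combo b l ≈P p)
            × (∀ l → combo b l ≈P 0P → ∀ n → coeff l n ≈ 0#)

  bShift : (Mono vs → Poly) → Var vs → Mono vs → Poly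
  bShift b i n with mdec vs i n
  ... | just m  = b m
  ... | nothing = 0P

  Bpow : (Var vs → Poly → Poly) → Mono vs → Poly → Poly
  Bpow B n p = List.foldr B p (mvars vs n)

  SumIs : (Mono vs → Poly) → Poly → Set ℓ
  SumIs f s = ∃ λ (S : List (Mono vs)) → Unique S
              × (∀ n → n ∉ S → f n ≈P 0P)
              × (sumP (List.map f S) ≈P s)

  OpSumAt : (Mono vs → Poly) → (Var vs → Poly → Poly) → Poly → Poly → Set ℓ
  OpSumAt a B p s = SumIs (λ n → a n *P Bpow B n p) s

module Submission where

-- Apply the operator to b_m.  Since the B_i are linear and B_i b_n = b_{n − e_i}, B^n b_m is b_{m − n}
-- when n ≤ m componentwise and 0 otherwise, so the value is ∑_{n ≤ m} a_n b_{m − n}: the term n = m is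
-- a_m b_0, and every other surviving term has |n| < |m|.  Comparing two expansions of the same operator
-- by induction on |m| therefore gives a_m b_0 = a′_m b_0.  Multiplication by b_0 is injective because
-- b_0(0) = 1: on coefficients it acts by a matrix that is unitriangular with respect to the degree.

open import Defs
open import Level using (Level)
open import Function using (_∘_)
open import Data.Nat as ℕ using (ℕ; zero; suc)
import Data.Nat.Properties as ℕP
open import Data.Nat.Induction using (<-wellFounded)
open import Induction.WellFounded as WF using ()
open import Relation.Binary.Construct.On as On using ()
open import Data.Fin as Fin using (Fin)
import Data.Fin.Properties as FinP
open import Data.Vec as Vec using (Vec; []; _∷_)
import Data.Vec.Properties as VecP
open import Data.List as List using (List; []; _∷_; _++_; deduplicate)
import Data.List.Properties as ListP
open import Data.List.Relation.Unary.Any using (here; there)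
open import Data.List.Relation.Unary.All as All using (_∷_)
open import Data.List.Relation.Unary.Unique.Propositional using (Unique; []; _∷_)
open import Data.List.Relation.Unary.Unique.DecPropositional.Properties using (deduplicate-!)
open import Data.List.Membership.Propositional using (_∈_; _∉_)
open import Data.List.Membership.Propositional.Properties using (∈-map⁺; ∈-++⁺ˡ; ∈-++⁺ʳ; ∈-deduplicate⁺)
open import Data.List.Membership.DecPropositional using () renaming (_∈?_ to ∈?)
open import Data.Maybe using (Maybe; just; nothing; _>>=_)
open import Data.Product using (∃; _×_; _,_; proj₁; proj₂)
open import Relation.Nullary using (yes; no)
open import Relation.Nullary.Negation using (contradiction)
open import Relation.Binary.Definitions using (DecidableEquality)
open import Relation.Binary.PropositionalEquality as ≡ using (_≡_; _≢_)
open import Algebra.Bundles using (CommutativeRing)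

module FiniteSums {c ℓ} (K : CommutativeRing c ℓ) where
  open CommutativeRing K
  open import Relation.Binary.Reasoning.Setoid setoid
  open import Algebra.Properties.Ring ring using (+-cancelˡ; +-cancelʳ)

  private variable
    a : Level
    A B : Set a

  ∑ : List A → (A → Carrier) → Carrier
  ∑ []       f = 0#
  ∑ (x ∷ xs) f = f x + ∑ xs f

  syntax ∑ xs (λ x → e) = ∑[ x ← xs ] e

  ∑-cong : ∀ xs {f g : A → Carrier} → (∀ x → x ∈ xs → f x ≈ g x) → ∑ xs f ≈ ∑ xs g
  ∑-cong []       f≈g = refl
  ∑-cong (x ∷ xs) f≈g = +-cong (f≈g x (here ≡.refl)) (∑-cong xs (λ y → f≈g y ∘ there))

  ∑-zero : ∀ xs {f : A → Carrier} → (∀ x → x ∈ xs → f x ≈ 0#) → ∑ xs f ≈ 0#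
  ∑-zero xs {f} f≈0 = trans (∑-cong xs f≈0) (∑-zero′ xs)
    where
    ∑-zero′ : ∀ (xs : List A) → ∑[ x ← xs ] 0# ≈ 0#
    ∑-zero′ []       = refl
    ∑-zero′ (x ∷ xs) = trans (+-identityˡ _) (∑-zero′ xs)

  ∑-++ : ∀ xs ys (f : A → Carrier) → ∑ (xs ++ ys) f ≈ ∑ xs f + ∑ ys f
  ∑-++ []       ys f = sym (+-identityˡ _)
  ∑-++ (x ∷ xs) ys f = trans (+-congˡ (∑-++ xs ys f)) (sym (+-assoc _ _ _))

  ∑-map : ∀ (g : B → A) xs (f : A → Carrier) → ∑ (List.map g xs) f ≡ ∑ xs (f ∘ g)
  ∑-map g []       f = ≡.refl
  ∑-map g (x ∷ xs) f = ≡.cong (f (g x) +_) (∑-map g xs f)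

  ∑-concatMap : ∀ (g : B → List A) xs (f : A → Carrier) →
                ∑ (List.concatMap g xs) f ≈ ∑[ x ← xs ] ∑ (g x) f
  ∑-concatMap g []       f = refl
  ∑-concatMap g (x ∷ xs) f = trans (∑-++ (g x) _ f) (+-congˡ (∑-concatMap g xs f))

  ∑-distrib-+ : ∀ xs (f g : A → Carrier) → ∑[ x ← xs ] (f x + g x) ≈ ∑ xs f + ∑ xs g
  ∑-distrib-+ []       f g = sym (+-identityˡ _)
  ∑-distrib-+ (x ∷ xs) f g = begin
    (f x + g x) + ∑[ x ← xs ] (f x + g x)  ≈⟨ +-congˡ (∑-distrib-+ xs f g) ⟩
    (f x + g x) + (∑ xs f + ∑ xs g)        ≈⟨ +-assoc _ _ _ ⟩
    f x + (g x + (∑ xs f + ∑ xs g))        ≈⟨ +-congˡ (x+[y+z]≈y+[x+z] _ _ _) ⟩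
    f x + (∑ xs f + (g x + ∑ xs g))        ≈⟨ +-assoc _ _ _ ⟨
    (f x + ∑ xs f) + (g x + ∑ xs g)        ∎
    where
    x+[y+z]≈y+[x+z] : ∀ x y z → x + (y + z) ≈ y + (x + z)
    x+[y+z]≈y+[x+z] x y z =
      trans (sym (+-assoc x y z)) (trans (+-congʳ (+-comm x y)) (+-assoc y x z))

  ∑-distribˡ-* : ∀ k xs (f : A → Carrier) → k * ∑ xs f ≈ ∑[ x ← xs ] (k * f x)
  ∑-distribˡ-* k []       f = zeroʳ k
  ∑-distribˡ-* k (x ∷ xs) f = trans (distribˡ k _ _) (+-congˡ (∑-distribˡ-* k xs f))

  ∑-distribʳ-* : ∀ k xs (f : A → Carrier) → ∑ xs f * k ≈ ∑[ x ← xs ] (f x * k)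
  ∑-distribʳ-* k []       f = zeroˡ k
  ∑-distribʳ-* k (x ∷ xs) f = trans (distribʳ k _ _) (+-congˡ (∑-distribʳ-* k xs f))

  ∑-comm : ∀ xs (ys : List B) (f : A → B → Carrier) →
           ∑[ x ← xs ] ∑[ y ← ys ] f x y ≈ ∑[ y ← ys ] ∑[ x ← xs ] f x y
  ∑-comm []       ys f = sym (∑-zero ys (λ _ _ → refl))
  ∑-comm (x ∷ xs) ys f = trans (+-congˡ (∑-comm xs ys f)) (sym (∑-distrib-+ ys (f x) _))

  ∑-cancel-at : ∀ {xs} {f g : A → Carrier} y → Unique xs → y ∈ xs →
                (∀ x → x ≢ y → f x ≈ g x) → ∑ xs f ≈ ∑ xs g → f y ≈ g y
  ∑-cancel-at {xs = x ∷ xs} {f} {g} y (x∉xs ∷ _) (here ≡.refl) f≈g ∑f≈∑g =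
    +-cancelʳ _ _ _ (trans ∑f≈∑g (+-congˡ (sym rest)))
    where
    rest : ∑ xs f ≈ ∑ xs g
    rest = ∑-cong xs λ z z∈xs → f≈g z λ { ≡.refl → All.lookup x∉xs z∈xs ≡.refl }
  ∑-cancel-at {xs = x ∷ xs} {f} {g} y (x∉xs ∷ !xs) (there y∈xs) f≈g ∑f≈∑g =
    ∑-cancel-at y !xs y∈xs f≈g (+-cancelˡ _ _ _ (trans (+-congʳ (sym f[x]≈g[x])) ∑f≈∑g))
    where
    f[x]≈g[x] : f x ≈ g x
    f[x]≈g[x] = f≈g x λ { ≡.refl → All.lookup x∉xs y∈xs ≡.refl }

  module _ {A : Set} (_≟_ : DecidableEquality A) where

    δ : A → A → Carrier
    δ x y with x ≟ y
    ... | yes _ = 1#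
    ... | no  _ = 0#

    δ-refl : ∀ x → δ x x ≈ 1#
    δ-refl x with x ≟ x
    ... | yes _   = refl
    ... | no  x≢x = contradiction ≡.refl x≢x

    δ-≢ : ∀ {x y} → x ≢ y → δ x y ≈ 0#
    δ-≢ {x} {y} x≢y with x ≟ y
    ... | yes x≡y = contradiction x≡y x≢y
    ... | no  _   = refl

    δ-cong : ∀ {x y x′ y′} → (x ≡ y → x′ ≡ y′) → (x′ ≡ y′ → x ≡ y) → δ x y ≈ δ x′ y′
    δ-cong {x} {y} {x′} {y′} ⇒ ⇐ with x ≟ y | x′ ≟ y′
    ... | yes _   | yes _    = refl
    ... | no  _   | no  _    = refl
    ... | yes x≡y | no  x′≢y′ = contradiction (⇒ x≡y) x′≢y′
    ... | no  x≢y | yes x′≡y′ = contradiction (⇐ x′≡y′) x≢y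

    δ*-swap : ∀ (f : A → Carrier) x y → δ x y * f y ≈ δ y x * f x
    δ*-swap f x y with x ≟ y
    ... | yes ≡.refl = *-congʳ (sym (δ-refl x))
    ... | no  x≢y    = trans (zeroˡ _) (sym (trans (*-congʳ (δ-≢ (x≢y ∘ ≡.sym))) (zeroˡ _)))

    ∑-single : ∀ {xs} {f : A → Carrier} y → Unique xs →
               (∀ x → x ≢ y → f x ≈ 0#) → (y ∉ xs → f y ≈ 0#) → ∑ xs f ≈ f y
    ∑-single {xs} {f} y !xs f≈0 f[y]≈0 with ∈? _≟_ y xs
    ... | no  y∉xs = trans (∑-zero xs (λ x x∈xs → f≈0 x λ { ≡.refl → y∉xs x∈xs })) (sym (f[y]≈0 y∉xs))
    ... | yes y∈xs = ∑-single-∈ xs !xs y∈xs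
      where
      ∑-single-∈ : ∀ xs → Unique xs → y ∈ xs → ∑ xs f ≈ f y
      ∑-single-∈ (x ∷ xs) (x∉xs ∷ _) (here ≡.refl) =
        trans (+-congˡ (∑-zero xs λ z z∈xs → f≈0 z λ { ≡.refl → All.lookup x∉xs z∈xs ≡.refl }))
              (+-identityʳ _)
      ∑-single-∈ (x ∷ xs) (x∉xs ∷ !xs) (there y∈xs) =
        trans (+-congʳ (f≈0 x λ { ≡.refl → All.lookup x∉xs y∈xs ≡.refl }))
              (trans (+-identityˡ _) (∑-single-∈ xs !xs y∈xs))

    ∑-δ : ∀ {xs} (f : A → Carrier) y → Unique xs → (y ∉ xs → f y ≈ 0#) →
          ∑[ x ← xs ] (δ y x * f x) ≈ f y
    ∑-δ f y !xs f[y]≈0 = trans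
      (∑-single y !xs (λ x x≢y → trans (*-congʳ (δ-≢ (x≢y ∘ ≡.sym))) (zeroˡ _))
                    (λ y∉xs → trans (*-congˡ (f[y]≈0 y∉xs)) (zeroʳ _)))
      (trans (*-congʳ (δ-refl y)) (*-identityˡ _))

    ∑-support : ∀ {xs ys} (f : A → Carrier) → Unique xs → Unique ys →
                (∀ x → x ∉ xs → f x ≈ 0#) → (∀ y → y ∉ ys → f y ≈ 0#) → ∑ xs f ≈ ∑ ys f
    ∑-support {xs} {ys} f !xs !ys f≈0₁ f≈0₂ = begin
      ∑ xs f                                 ≈⟨ ∑-cong xs (λ x _ → ∑-δ f x !ys (f≈0₂ x)) ⟨
      ∑[ x ← xs ] ∑[ y ← ys ] (δ x y * f y)  ≈⟨ ∑-comm xs ys _ ⟩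
      ∑[ y ← ys ] ∑[ x ← xs ] (δ x y * f y)  ≈⟨ ∑-cong ys (λ y _ → ∑-cong xs λ x _ → δ*-swap f x y) ⟩
      ∑[ y ← ys ] ∑[ x ← xs ] (δ y x * f x)  ≈⟨ ∑-cong ys (λ y _ → ∑-δ f y !xs (f≈0₁ y)) ⟩
      ∑ ys f                                 ∎

module MultiIndices where
  open import Data.Nat using (_+_; _≤_; _<_)
  open import Data.Nat.Solver using (module +-*-Solver)
  open +-*-Solver using (solve; _:+_; _:=_)
  open import Relation.Binary.PropositionalEquality

  varEq : ∀ vs → DecidableEquality (Var vs)
  varEq (finite d) = Fin._≟_
  varEq infinite   = ℕ._≟_

  module _ {vs : VarSpec} where

    δℕ : Var vs → Var vs → ℕ
    δℕ i j with varEq vs i j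
    ... | yes _ = 1
    ... | no  _ = 0

    multiplicity : Var vs → List (Var vs) → ℕ
    multiplicity j []       = 0
    multiplicity j (i ∷ is) = δℕ i j + multiplicity j is

    δℕ-refl : ∀ i → δℕ i i ≡ 1
    δℕ-refl i with varEq vs i i
    ... | yes _   = refl
    ... | no  i≢i = contradiction refl i≢i

    δℕ-≢ : ∀ {i j} → i ≢ j → δℕ i j ≡ 0
    δℕ-≢ {i} {j} i≢j with varEq vs i j
    ... | yes i≡j = contradiction i≡j i≢j
    ... | no  _   = refl

    multiplicity-++ : ∀ j is is′ → multiplicity j (is ++ is′) ≡ multiplicity j is + multiplicity j is′
    multiplicity-++ j []       is′ = refl
    multiplicity-++ j (i ∷ is) is′ =
      trans (cong (δℕ i j +_) (multiplicity-++ j is is′)) (sym (ℕP.+-assoc (δℕ i j) _ _))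

    multiplicity-replicate-self : ∀ i k → multiplicity i (List.replicate k i) ≡ k
    multiplicity-replicate-self i zero    = refl
    multiplicity-replicate-self i (suc k) = cong₂ _+_ (δℕ-refl i) (multiplicity-replicate-self i k)

    multiplicity-replicate-≢ : ∀ {i j} k → i ≢ j → multiplicity j (List.replicate k i) ≡ 0
    multiplicity-replicate-≢ zero    i≢j = refl
    multiplicity-replicate-≢ (suc k) i≢j = cong₂ _+_ (δℕ-≢ i≢j) (multiplicity-replicate-≢ k i≢j)

  module _ {vs vs′ : VarSpec} (h : Var vs → Var vs′) where

    multiplicity-map : (∀ {i j} → h i ≡ h j → i ≡ j) →
                       ∀ j is → multiplicity (h j) (List.map h is) ≡ multiplicity j is
    multiplicity-map h-injective j []       = refl
    multiplicity-map h-injective j (i ∷ is) =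
      cong₂ _+_ δℕ-map (multiplicity-map h-injective j is)
      where
      δℕ-map : δℕ (h i) (h j) ≡ δℕ i j
      δℕ-map with varEq vs i j
      ... | yes refl = δℕ-refl (h i)
      ... | no  i≢j  = δℕ-≢ (i≢j ∘ h-injective)

    multiplicity-map-∉ : ∀ {j′} → (∀ i → h i ≢ j′) → ∀ is → multiplicity j′ (List.map h is) ≡ 0
    multiplicity-map-∉ h≢j′ []       = refl
    multiplicity-map-∉ h≢j′ (i ∷ is) = cong₂ _+_ (δℕ-≢ (h≢j′ i)) (multiplicity-map-∉ h≢j′ is)

  record MultiIndexLaws (vs : VarSpec) : Set where
    field
      deg                    : Mono vs → ℕ
      exponent               : Mono vs → Var vs → ℕ
      deg-madd               : ∀ m n → deg (madd vs m n) ≡ deg m + deg n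
      deg≡0⇒≡mzero           : ∀ n → deg n ≡ 0 → n ≡ mzero vs
      madd-identityʳ         : ∀ n → madd vs n (mzero vs) ≡ n
      exponent-ext           : ∀ m n → (∀ j → exponent m j ≡ exponent n j) → m ≡ n
      exponent-mzero         : ∀ j → exponent (mzero vs) j ≡ 0
      mdec-deg               : ∀ i m k → mdec vs i m ≡ just k → deg m ≡ suc (deg k)
      mdec-exponent          : ∀ i m k → mdec vs i m ≡ just k →
                               ∀ j → exponent m j ≡ δℕ i j + exponent k j
      exponent≡suc⇒mdec-just : ∀ i m e → exponent m i ≡ suc e → ∃ λ k → mdec vs i m ≡ just k
      multiplicity-mvars     : ∀ n j → multiplicity j (mvars vs n) ≡ exponent n j
      length-mvars           : ∀ n → List.length (mvars vs n) ≡ deg n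

  private
    m+n≤m⇒n≡0 : ∀ m n → m + n ≤ m → n ≡ 0
    m+n≤m⇒n≡0 m n m+n≤m =
      ℕP.n≤0⇒n≡0 (ℕP.+-cancelˡ-≤ m n 0 (subst (m + n ≤_) (sym (ℕP.+-identityʳ m)) m+n≤m))

  module MultiIndexProperties {vs : VarSpec} (laws : MultiIndexLaws vs) where
    open MultiIndexLaws laws

    +deg≤⇒≡mzero : ∀ a k → a + deg k ≤ a → k ≡ mzero vs
    +deg≤⇒≡mzero a k = deg≡0⇒≡mzero k ∘ m+n≤m⇒n≡0 a (deg k)

    deg-induction : ∀ {p} (P : Mono vs → Set p) → (∀ m → (∀ n → deg n < deg m → P n) → P m) → ∀ m → P m
    deg-induction P step = WF.All.wfRec (On.wellFounded deg <-wellFounded) _ P λ m rec → step m λ n → rec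

    madd-deg≤⇒≡mzero : ∀ v w → deg (madd vs v w) ≤ deg v → w ≡ mzero vs
    madd-deg≤⇒≡mzero v w = +deg≤⇒≡mzero (deg v) w ∘ subst (_≤ deg v) (deg-madd v w)

    mdecs : List (Var vs) → Mono vs → Maybe (Mono vs)
    mdecs is m = List.foldr (λ i k → k >>= mdec vs i) (just m) is

    mdecs-just : ∀ is m k → mdecs is m ≡ just k →
                 deg m ≡ List.length is + deg k × (∀ j → exponent m j ≡ multiplicity j is + exponent k j)
    mdecs-just []       m k refl = refl , λ j → refl
    mdecs-just (i ∷ is) m k eq with mdecs is m in eq′
    ... | just k′ with mdecs-just is m k′ eq′
    ...   | deg-m , exponent-m = deg-step , exponent-step
      where
      deg-step : deg m ≡ suc (List.length is + deg k)
      deg-step = trans deg-m (trans (cong (List.length is +_) (mdec-deg i k′ k eq)) (ℕP.+-suc _ _))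
      exponent-step : ∀ j → exponent m j ≡ (δℕ i j + multiplicity j is) + exponent k j
      exponent-step j = begin
        exponent m j                                   ≡⟨ exponent-m j ⟩
        multiplicity j is + exponent k′ j              ≡⟨ cong (multiplicity j is +_) (mdec-exponent i k′ k eq j) ⟩
        multiplicity j is + (δℕ i j + exponent k j)    ≡⟨ sym (ℕP.+-assoc (multiplicity j is) _ _) ⟩
        (multiplicity j is + δℕ i j) + exponent k j    ≡⟨ cong (_+ exponent k j) (ℕP.+-comm (multiplicity j is) _) ⟩
        (δℕ i j + multiplicity j is) + exponent k j    ∎
        where open ≡-Reasoning

    mdecs-defined : ∀ is m → (∀ j → multiplicity j is ≤ exponent m j) → ∃ λ k → mdecs is m ≡ just k
    mdecs-defined []       m _  = m , refl
    mdecs-defined (i ∷ is) m is≤m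
      with mdecs-defined is m (λ j → ℕP.≤-trans (ℕP.m≤n+m _ (δℕ i j)) (is≤m j))
    ... | k′ , eq′ rewrite eq′ = positive (exponent k′ i) refl
      where
      room-for-i : suc (multiplicity i is) ≤ multiplicity i is + exponent k′ i
      room-for-i = subst₂ _≤_ (cong (_+ multiplicity i is) (δℕ-refl i))
                        (proj₂ (mdecs-just is m k′ eq′) i) (is≤m i)
      positive : ∀ e → exponent k′ i ≡ e → ∃ λ k → mdec vs i k′ ≡ just k
      positive zero    eq = contradiction
        (subst (suc (multiplicity i is) ≤_) (trans (cong (multiplicity i is +_) eq) (ℕP.+-identityʳ _)) room-for-i)
        (ℕP.n≮n _)
      positive (suc e) eq = exponent≡suc⇒mdec-just i k′ e eq

    mdecs-mvars-self : ∀ m → mdecs (mvars vs m) m ≡ just (mzero vs)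
    mdecs-mvars-self m with mdecs-defined (mvars vs m) m (λ j → ℕP.≤-reflexive (multiplicity-mvars m j))
    ... | k , eq with mdecs-just (mvars vs m) m k eq
    ...   | deg-m , _ = trans eq (cong just (+deg≤⇒≡mzero (deg m) k deg-m≥))
      where
      deg-m≥ : deg m + deg k ≤ deg m
      deg-m≥ = ℕP.≤-reflexive (trans (cong (_+ deg k) (sym (length-mvars m))) (sym deg-m))

    mdecs-mvars-deg≤⇒≡ : ∀ n m k → mdecs (mvars vs n) m ≡ just k → deg m ≤ deg n → n ≡ m
    mdecs-mvars-deg≤⇒≡ n m k eq m≤n with mdecs-just (mvars vs n) m k eq
    ... | deg-m , exponent-m with +deg≤⇒≡mzero (deg n) k deg-n≥
      where
      deg-n≥ : deg n + deg k ≤ deg n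
      deg-n≥ = ℕP.≤-trans (ℕP.≤-reflexive (trans (cong (_+ deg k) (sym (length-mvars n))) (sym deg-m))) m≤n
    ... | refl = exponent-ext n m λ j → sym (begin
        exponent m j                                         ≡⟨ exponent-m j ⟩
        multiplicity j (mvars vs n) + exponent (mzero vs) j  ≡⟨ cong₂ _+_ (multiplicity-mvars n j) (exponent-mzero j) ⟩
        exponent n j + 0                                     ≡⟨ ℕP.+-identityʳ _ ⟩
        exponent n j                                         ∎)
      where open ≡-Reasoning

  module Infinite where

    degₚ : Pos → ℕ
    degₚ (last k) = suc k
    degₚ (x ∷ₚ p) = x + degₚ p

    degₛ : Seq → ℕ
    degₛ zeroₛ   = 0
    degₛ (pos p) = degₚ p

    exponentₚ : Pos → ℕ → ℕ
    exponentₚ (last k) zero    = suc k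
    exponentₚ (last k) (suc j) = 0
    exponentₚ (x ∷ₚ p) zero    = x
    exponentₚ (x ∷ₚ p) (suc j) = exponentₚ p j

    exponentₛ : Seq → ℕ → ℕ
    exponentₛ zeroₛ   j = 0
    exponentₛ (pos p) j = exponentₚ p j

    degₚ-addₚ : ∀ p q → degₚ (addₚ p q) ≡ degₚ p + degₚ q
    degₚ-addₚ (last a) (last b) = cong suc (sym (ℕP.+-suc a b))
    degₚ-addₚ (last a) (y ∷ₚ q) = ℕP.+-assoc (suc a) y (degₚ q)
    degₚ-addₚ (x ∷ₚ p) (last b) = solve 3 (λ x b d → (x :+ b) :+ d := (x :+ d) :+ b) refl x (suc b) (degₚ p)
    degₚ-addₚ (x ∷ₚ p) (y ∷ₚ q) = trans (cong ((x + y) +_) (degₚ-addₚ p q))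
      (solve 4 (λ x y a b → (x :+ y) :+ (a :+ b) := (x :+ a) :+ (y :+ b)) refl x y (degₚ p) (degₚ q))

    degₛ-madd : ∀ m n → degₛ (madd infinite m n) ≡ degₛ m + degₛ n
    degₛ-madd zeroₛ   n       = refl
    degₛ-madd (pos p) zeroₛ   = sym (ℕP.+-identityʳ _)
    degₛ-madd (pos p) (pos q) = degₚ-addₚ p q

    degₚ≢0 : ∀ p → degₚ p ≢ 0
    degₚ≢0 (last k) ()
    degₚ≢0 (x ∷ₚ p) eq = degₚ≢0 p (ℕP.m+n≡0⇒n≡0 x eq)

    degₛ≡0⇒≡zeroₛ : ∀ n → degₛ n ≡ 0 → n ≡ zeroₛ
    degₛ≡0⇒≡zeroₛ zeroₛ   _  = refl
    degₛ≡0⇒≡zeroₛ (pos p) eq = contradiction eq (degₚ≢0 p)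

    exponentₚ-nonzero : ∀ p → ∃ λ j → exponentₚ p j ≢ 0
    exponentₚ-nonzero (last k) = 0 , λ ()
    exponentₚ-nonzero (x ∷ₚ p) with exponentₚ-nonzero p
    ... | j , nonzero = suc j , nonzero

    exponentₚ-ext : ∀ p q → (∀ j → exponentₚ p j ≡ exponentₚ q j) → p ≡ q
    exponentₚ-ext (last a) (last b) eq = cong last (ℕP.suc-injective (eq 0))
    exponentₚ-ext (last a) (y ∷ₚ q) eq with exponentₚ-nonzero q
    ... | j , nonzero = contradiction (sym (eq (suc j))) nonzero
    exponentₚ-ext (x ∷ₚ p) (last b) eq with exponentₚ-nonzero p
    ... | j , nonzero = contradiction (eq (suc j)) nonzero
    exponentₚ-ext (x ∷ₚ p) (y ∷ₚ q) eq = cong₂ _∷ₚ_ (eq 0) (exponentₚ-ext p q (eq ∘ suc))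

    exponentₛ-ext : ∀ m n → (∀ j → exponentₛ m j ≡ exponentₛ n j) → m ≡ n
    exponentₛ-ext zeroₛ   zeroₛ   eq = refl
    exponentₛ-ext zeroₛ   (pos q) eq with exponentₚ-nonzero q
    ... | j , nonzero = contradiction (sym (eq j)) nonzero
    exponentₛ-ext (pos p) zeroₛ   eq with exponentₚ-nonzero p
    ... | j , nonzero = contradiction (eq j) nonzero
    exponentₛ-ext (pos p) (pos q) eq = cong pos (exponentₚ-ext p q eq)

    exponentₛ-consₛ-zero : ∀ x n → exponentₛ (consₛ x n) 0 ≡ x
    exponentₛ-consₛ-zero zero    zeroₛ   = refl
    exponentₛ-consₛ-zero (suc x) zeroₛ   = refl
    exponentₛ-consₛ-zero zero    (pos p) = refl
    exponentₛ-consₛ-zero (suc x) (pos p) = refl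

    exponentₛ-consₛ-suc : ∀ x n j → exponentₛ (consₛ x n) (suc j) ≡ exponentₛ n j
    exponentₛ-consₛ-suc zero    zeroₛ   j = refl
    exponentₛ-consₛ-suc (suc x) zeroₛ   j = refl
    exponentₛ-consₛ-suc zero    (pos p) j = refl
    exponentₛ-consₛ-suc (suc x) (pos p) j = refl

    degₛ-consₛ : ∀ x n → degₛ (consₛ x n) ≡ x + degₛ n
    degₛ-consₛ zero    zeroₛ   = refl
    degₛ-consₛ (suc x) zeroₛ   = cong suc (sym (ℕP.+-identityʳ x))
    degₛ-consₛ zero    (pos p) = refl
    degₛ-consₛ (suc x) (pos p) = refl

    δℕ-suc : ∀ i j → δℕ {infinite} (suc i) (suc j) ≡ δℕ i j
    δℕ-suc i j with i ℕ.≟ j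
    ... | yes refl = δℕ-refl (suc i)
    ... | no  i≢j  = δℕ-≢ (i≢j ∘ ℕP.suc-injective)

    decₚ-deg : ∀ i p n → decₚ i p ≡ just n → degₚ p ≡ suc (degₛ n)
    decₚ-deg zero    (last k)      n refl = cong suc (sym (trans (degₛ-consₛ k zeroₛ) (ℕP.+-identityʳ k)))
    decₚ-deg zero    (suc x ∷ₚ p)  n refl = refl
    decₚ-deg (suc i) (x ∷ₚ p)      n eq with decₚ i p in eq′
    ... | just n′ with refl ← eq =
      trans (cong (x +_) (decₚ-deg i p n′ eq′)) (trans (ℕP.+-suc x _) (cong suc (sym (degₛ-consₛ x n′))))

    decₚ-exponent : ∀ i p n → decₚ i p ≡ just n → ∀ j → exponentₚ p j ≡ δℕ i j + exponentₛ n j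
    decₚ-exponent zero    (last k)     n refl zero    = cong suc (sym (exponentₛ-consₛ-zero k zeroₛ))
    decₚ-exponent zero    (last k)     n refl (suc j) = sym (exponentₛ-consₛ-suc k zeroₛ j)
    decₚ-exponent zero    (suc x ∷ₚ p) n refl zero    = refl
    decₚ-exponent zero    (suc x ∷ₚ p) n refl (suc j) = refl
    decₚ-exponent (suc i) (x ∷ₚ p)     n eq   j with decₚ i p in eq′
    decₚ-exponent (suc i) (x ∷ₚ p)     n refl zero    | just n′ = sym (exponentₛ-consₛ-zero x n′)
    decₚ-exponent (suc i) (x ∷ₚ p)     n refl (suc j) | just n′ =
      trans (decₚ-exponent i p n′ eq′ j) (sym (cong₂ _+_ (δℕ-suc i j) (exponentₛ-consₛ-suc x n′ j)))

    decₚ-just : ∀ i p e → exponentₚ p i ≡ suc e → ∃ λ n → decₚ i p ≡ just n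
    decₚ-just zero    (last k)     e eq = _ , refl
    decₚ-just zero    (suc x ∷ₚ p) e eq = _ , refl
    decₚ-just (suc i) (x ∷ₚ p)     e eq with decₚ-just i p e eq
    ... | n′ , eq′ rewrite eq′ = _ , refl

    varsₚ-suc : ∀ i p → varsₚ (suc i) p ≡ List.map suc (varsₚ i p)
    varsₚ-suc i (last k) = sym (ListP.map-replicate suc (suc k) i)
    varsₚ-suc i (x ∷ₚ p) = trans (cong₂ _++_ (sym (ListP.map-replicate suc x i)) (varsₚ-suc (suc i) p))
                                 (sym (ListP.map-++ suc (List.replicate x i) (varsₚ (suc i) p)))

    multiplicity-varsₚ : ∀ p j → multiplicity {infinite} j (varsₚ 0 p) ≡ exponentₚ p j
    multiplicity-varsₚ (last k) zero    = multiplicity-replicate-self 0 (suc k)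
    multiplicity-varsₚ (last k) (suc j) = multiplicity-replicate-≢ {infinite} {0} {suc j} (suc k) (λ ())
    multiplicity-varsₚ (x ∷ₚ p) j
      rewrite multiplicity-++ j (List.replicate x 0) (varsₚ 1 p) | varsₚ-suc 0 p with j
    ... | zero   = trans (cong₂ _+_ (multiplicity-replicate-self 0 x) (multiplicity-map-∉ suc (λ _ ()) (varsₚ 0 p)))
                         (ℕP.+-identityʳ x)
    ... | suc j′ = trans (cong₂ _+_ (multiplicity-replicate-≢ {infinite} {0} {suc j′} x (λ ()))
                                    (multiplicity-map suc ℕP.suc-injective j′ (varsₚ 0 p)))
                         (multiplicity-varsₚ p j′)

    length-varsₚ : ∀ i p → List.length (varsₚ i p) ≡ degₚ p
    length-varsₚ i (last k) = ListP.length-replicate (suc k)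
    length-varsₚ i (x ∷ₚ p) = trans (ListP.length-++ (List.replicate x i))
                                    (cong₂ _+_ (ListP.length-replicate x) (length-varsₚ (suc i) p))

    laws : MultiIndexLaws infinite
    laws = record
      { deg                    = degₛ
      ; exponent               = exponentₛ
      ; deg-madd               = degₛ-madd
      ; deg≡0⇒≡mzero           = degₛ≡0⇒≡zeroₛ
      ; madd-identityʳ         = λ { zeroₛ → refl ; (pos p) → refl }
      ; exponent-ext           = exponentₛ-ext
      ; exponent-mzero         = λ j → refl
      ; mdec-deg               = λ { i (pos p) k eq → decₚ-deg i p k eq }
      ; mdec-exponent          = λ { i (pos p) k eq → decₚ-exponent i p k eq }
      ; exponent≡suc⇒mdec-just = λ { i (pos p) e eq → decₚ-just i p e eq }
      ; multiplicity-mvars     = λ { zeroₛ j → refl ; (pos p) j → multiplicity-varsₚ p j }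
      ; length-mvars           = λ { zeroₛ → refl ; (pos p) → length-varsₚ 0 p }
      }

  module Finite where

    sum-zipWith-+ : ∀ {d} (m n : Vec ℕ d) → Vec.sum (Vec.zipWith _+_ m n) ≡ Vec.sum m + Vec.sum n
    sum-zipWith-+ []       []       = refl
    sum-zipWith-+ (x ∷ m) (y ∷ n) = trans (cong ((x + y) +_) (sum-zipWith-+ m n))
      (solve 4 (λ x y a b → (x :+ y) :+ (a :+ b) := (x :+ a) :+ (y :+ b)) refl x y (Vec.sum m) (Vec.sum n))

    sum≡0⇒≡replicate : ∀ {d} (n : Vec ℕ d) → Vec.sum n ≡ 0 → n ≡ Vec.replicate d 0
    sum≡0⇒≡replicate []      _  = refl
    sum≡0⇒≡replicate (x ∷ n) eq =
      cong₂ _∷_ (ℕP.m+n≡0⇒m≡0 x eq) (sum≡0⇒≡replicate n (ℕP.m+n≡0⇒n≡0 x eq))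

    lookup-ext : ∀ {d} (m n : Vec ℕ d) → (∀ j → Vec.lookup m j ≡ Vec.lookup n j) → m ≡ n
    lookup-ext m n eq = trans (sym (VecP.tabulate∘lookup m)) (trans (VecP.tabulate-cong eq) (VecP.tabulate∘lookup n))

    sum-update : ∀ {d} (i : Fin d) (n : Vec ℕ d) k → Vec.lookup n i ≡ suc k →
                 Vec.sum n ≡ suc (Vec.sum (n Vec.[ i ]≔ k))
    sum-update Fin.zero    (x ∷ n) k refl = refl
    sum-update (Fin.suc i) (x ∷ n) k eq   = trans (cong (x +_) (sum-update i n k eq)) (ℕP.+-suc x _)

    mvars-∷ : ∀ {d} x (n : Vec ℕ d) →
              mvars (finite (suc d)) (x ∷ n) ≡ List.replicate x Fin.zero ++ List.map Fin.suc (mvars (finite d) n)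
    mvars-∷ {d} x n = cong (List.replicate x Fin.zero ++_) (begin
      List.concat (List.map g (List.tabulate Fin.suc))              ≡⟨ cong List.concat (ListP.map-tabulate Fin.suc g) ⟩
      List.concat (List.tabulate (g ∘ Fin.suc))                     ≡⟨ cong List.concat (ListP.tabulate-cong g∘suc) ⟩
      List.concat (List.tabulate (List.map Fin.suc ∘ g′))           ≡⟨ cong List.concat (ListP.map-tabulate g′ _) ⟨
      List.concat (List.map (List.map Fin.suc) (List.tabulate g′))  ≡⟨ ListP.concat-map (List.tabulate g′) ⟩
      List.map Fin.suc (List.concat (List.tabulate g′))             ≡⟨ cong (List.map Fin.suc ∘ List.concat) (ListP.map-tabulate (λ i → i) g′) ⟨
      List.map Fin.suc (mvars (finite _) n)                         ∎)
      where
      open ≡-Reasoning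
      g : Fin (suc d) → List (Fin (suc d))
      g i = List.replicate (Vec.lookup (x ∷ n) i) i
      g′ : Fin d → List (Fin d)
      g′ i = List.replicate (Vec.lookup n i) i
      g∘suc : ∀ i → g (Fin.suc i) ≡ List.map Fin.suc (g′ i)
      g∘suc i = sym (ListP.map-replicate Fin.suc (Vec.lookup n i) i)

    multiplicity-mvars : ∀ {d} (n : Vec ℕ d) j → multiplicity j (mvars (finite d) n) ≡ Vec.lookup n j
    multiplicity-mvars {suc d} (x ∷ n) j
      rewrite mvars-∷ x n | multiplicity-++ j (List.replicate x Fin.zero) (List.map Fin.suc (mvars (finite d) n)) with j
    ... | Fin.zero   = trans (cong₂ _+_ (multiplicity-replicate-self Fin.zero x)
                                        (multiplicity-map-∉ Fin.suc (λ _ ()) (mvars (finite d) n)))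
                             (ℕP.+-identityʳ x)
    ... | Fin.suc j′ = trans (cong₂ _+_ (multiplicity-replicate-≢ {finite (suc d)} {Fin.zero} {Fin.suc j′} x (λ ()))
                                        (multiplicity-map Fin.suc FinP.suc-injective j′ (mvars (finite d) n)))
                             (multiplicity-mvars n j′)

    length-mvars : ∀ {d} (n : Vec ℕ d) → List.length (mvars (finite d) n) ≡ Vec.sum n
    length-mvars []      = refl
    length-mvars (x ∷ n) rewrite mvars-∷ x n =
      trans (ListP.length-++ (List.replicate x Fin.zero))
            (cong₂ _+_ (ListP.length-replicate x) (trans (ListP.length-map Fin.suc (mvars (finite _) n)) (length-mvars n)))

    mdec-deg : ∀ {d} i n k → mdec (finite d) i n ≡ just k → Vec.sum n ≡ suc (Vec.sum k)
    mdec-deg i n k eq with Vec.lookup n i in eq′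
    mdec-deg i n k refl | suc e = sum-update i n e eq′

    mdec-exponent : ∀ {d} i n k → mdec (finite d) i n ≡ just k → ∀ j → Vec.lookup n j ≡ δℕ i j + Vec.lookup k j
    mdec-exponent i n k eq j with Vec.lookup n i in eq′
    mdec-exponent i n k refl j | suc e with i Fin.≟ j
    ... | yes refl = trans eq′ (sym (cong suc (VecP.lookup∘update i n e)))
    ... | no  i≢j  = sym (VecP.lookup∘update′ (i≢j ∘ sym) n e)

    mdec-just : ∀ {d} i n e → Vec.lookup n i ≡ suc e → ∃ λ k → mdec (finite d) i n ≡ just k
    mdec-just i n e eq with Vec.lookup n i
    mdec-just i n e refl | .(suc e) = _ , refl

    laws : ∀ d → MultiIndexLaws (finite d)
    laws d = record
      { deg                    = Vec.sum
      ; exponent               = Vec.lookup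
      ; deg-madd               = sum-zipWith-+
      ; deg≡0⇒≡mzero           = sum≡0⇒≡replicate
      ; madd-identityʳ         = VecP.zipWith-identityʳ ℕP.+-identityʳ
      ; exponent-ext           = lookup-ext
      ; exponent-mzero         = λ j → VecP.lookup-replicate j 0
      ; mdec-deg               = mdec-deg
      ; mdec-exponent          = mdec-exponent
      ; exponent≡suc⇒mdec-just = mdec-just
      ; multiplicity-mvars     = multiplicity-mvars
      ; length-mvars           = length-mvars
      }

  multiIndexLaws : ∀ vs → MultiIndexLaws vs
  multiIndexLaws (finite d) = Finite.laws d
  multiIndexLaws infinite   = Infinite.laws

open MultiIndices

module Polynomials {c ℓ} (K : CommutativeRing c ℓ) (vs : VarSpec) where
  open CommutativeRing K
  open PolyDefs K vs
  open FiniteSums K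
  open import Relation.Binary.Reasoning.Setoid setoid

  δₘ : Mono vs → Mono vs → Carrier
  δₘ = δ (meq vs)

  monomials : Poly → List (Mono vs)
  monomials = List.map proj₂

  ⟪_,_⟫ : Poly → (Mono vs → Carrier) → Carrier
  ⟪ p , g ⟫ = ∑ p λ (a , v) → a * g v

  ⟪⟫-cong : ∀ p {g h} → (∀ v → v ∈ monomials p → g v ≈ h v) → ⟪ p , g ⟫ ≈ ⟪ p , h ⟫
  ⟪⟫-cong p g≈h = ∑-cong p λ (a , v) t∈p → *-congˡ (g≈h v (∈-map⁺ proj₂ t∈p))

  ⟪⟫-*ʳ : ∀ p g k → ⟪ p , g ⟫ * k ≈ ⟪ p , (λ v → g v * k) ⟫
  ⟪⟫-*ʳ p g k = trans (∑-distribʳ-* k p _) (∑-cong p λ _ _ → *-assoc _ _ _)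

  ∑-⟪⟫ : ∀ {A : Set} (xs : List A) p (h : A → Mono vs → Carrier) →
         ∑[ x ← xs ] ⟪ p , h x ⟫ ≈ ⟪ p , (λ v → ∑[ x ← xs ] h x v) ⟫
  ∑-⟪⟫ xs p h = trans (∑-comm xs p _) (∑-cong p λ _ _ → sym (∑-distribˡ-* _ xs _))

  ⟪⟫-·P : ∀ k p g → ⟪ k ·P p , g ⟫ ≈ k * ⟪ p , g ⟫
  ⟪⟫-·P k p g = begin
    ⟪ k ·P p , g ⟫                       ≡⟨ ∑-map _ p _ ⟩
    ∑[ (a , v) ← p ] ((k * a) * g v)     ≈⟨ ∑-cong p (λ _ _ → *-assoc _ _ _) ⟩
    ∑[ (a , v) ← p ] (k * (a * g v))     ≈⟨ ∑-distribˡ-* k p _ ⟨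
    k * ⟪ p , g ⟫                        ∎

  ⟪⟫-*P : ∀ p q g → ⟪ p *P q , g ⟫ ≈ ⟪ p , (λ u → ⟪ q , (λ v → g (madd vs u v)) ⟫) ⟫
  ⟪⟫-*P p q g = trans (∑-concatMap _ p _) (∑-cong p λ (a , u) _ → begin
    ∑ (List.map _ q) _                           ≡⟨ ∑-map _ q _ ⟩
    ∑[ (b , v) ← q ] ((a * b) * g (madd vs u v)) ≈⟨ ∑-cong q (λ _ _ → *-assoc _ _ _) ⟩
    ∑[ (b , v) ← q ] (a * (b * g (madd vs u v))) ≈⟨ ∑-distribˡ-* a q _ ⟨
    a * ⟪ q , (λ v → g (madd vs u v)) ⟫          ∎)

  coeff≈⟪⟫ : ∀ p u → coeff p u ≈ ⟪ p , (λ v → δₘ v u) ⟫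
  coeff≈⟪⟫ []            u = refl
  coeff≈⟪⟫ ((a , v) ∷ p) u with meq vs v u
  ... | yes _ = +-cong (sym (*-identityʳ a)) (coeff≈⟪⟫ p u)
  ... | no  _ = trans (coeff≈⟪⟫ p u) (sym (trans (+-congʳ (zeroʳ a)) (+-identityˡ _)))

  coeff-∉ : ∀ p u → u ∉ monomials p → coeff p u ≈ 0#
  coeff-∉ p u u∉p = trans (coeff≈⟪⟫ p u) (∑-zero p λ (a , v) t∈p →
    trans (*-congˡ (δ-≢ (meq vs) λ { ≡.refl → u∉p (∈-map⁺ proj₂ t∈p) })) (zeroʳ a))

  ⟪⟫≈∑-coeff : ∀ p g {V} → Unique V → (∀ v → v ∈ monomials p → v ∈ V) →
               ⟪ p , g ⟫ ≈ ∑[ v ← V ] (coeff p v * g v)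
  ⟪⟫≈∑-coeff p g {V} !V p⊆V = sym (begin
    ∑[ v ← V ] (coeff p v * g v)
      ≈⟨ ∑-cong V (λ v _ → trans (*-congʳ (coeff≈⟪⟫ p v)) (⟪⟫-*ʳ p _ (g v))) ⟩
    ∑[ v ← V ] ⟪ p , (λ w → δₘ w v * g v) ⟫
      ≈⟨ ∑-⟪⟫ V p _ ⟩
    ⟪ p , (λ w → ∑[ v ← V ] (δₘ w v * g v)) ⟫
      ≈⟨ ⟪⟫-cong p (λ w w∈p → ∑-δ (meq vs) g w !V (contradiction (p⊆V w w∈p))) ⟩
    ⟪ p , g ⟫ ∎)

  ⟪⟫-resp-≈P : ∀ g {p q} → p ≈P q → ⟪ p , g ⟫ ≈ ⟪ q , g ⟫
  ⟪⟫-resp-≈P g {p} {q} p≈q = begin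
    ⟪ p , g ⟫                     ≈⟨ ⟪⟫≈∑-coeff p g !V (λ _ → p∪q⊆V ∘ ∈-++⁺ˡ) ⟩
    ∑[ v ← V ] (coeff p v * g v)  ≈⟨ ∑-cong V (λ v _ → *-congʳ (p≈q v)) ⟩
    ∑[ v ← V ] (coeff q v * g v)  ≈⟨ ⟪⟫≈∑-coeff q g !V (λ _ → p∪q⊆V ∘ ∈-++⁺ʳ (monomials p)) ⟨
    ⟪ q , g ⟫                     ∎
    where
    V : List (Mono vs)
    V = deduplicate (meq vs) (monomials p ++ monomials q)
    !V : Unique V
    !V = deduplicate-! (meq vs) (monomials p ++ monomials q)
    p∪q⊆V : ∀ {v} → v ∈ monomials p ++ monomials q → v ∈ V
    p∪q⊆V = ∈-deduplicate⁺ (meq vs)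

  coeff-+P : ∀ p q u → coeff (p +P q) u ≈ coeff p u + coeff q u
  coeff-+P p q u =
    trans (coeff≈⟪⟫ (p +P q) u) (trans (∑-++ p q _) (sym (+-cong (coeff≈⟪⟫ p u) (coeff≈⟪⟫ q u))))

  coeff-sumP : ∀ {A : Set} (f : A → Poly) xs u → coeff (sumP (List.map f xs)) u ≈ ∑[ x ← xs ] coeff (f x) u
  coeff-sumP f []       u = refl
  coeff-sumP f (x ∷ xs) u = trans (coeff-+P (f x) _ u) (+-congˡ (coeff-sumP f xs u))

  -- the coefficient of x^u in x^v · q
  shiftCoeff : Poly → Mono vs → Mono vs → Carrier
  shiftCoeff q v u = ⟪ q , (λ w → δₘ (madd vs v w) u) ⟫

  coeff-*P : ∀ p q u → coeff (p *P q) u ≈ ⟪ p , (λ v → shiftCoeff q v u) ⟫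
  coeff-*P p q u = trans (coeff≈⟪⟫ (p *P q) u) (⟪⟫-*P p q _)

  *P-congʳ : ∀ {p p′} q → p ≈P p′ → p *P q ≈P p′ *P q
  *P-congʳ {p} {p′} q p≈p′ u =
    trans (coeff-*P p q u) (trans (⟪⟫-resp-≈P (λ v → shiftCoeff q v u) {p} {p′} p≈p′)
                                  (sym (coeff-*P p′ q u)))

  *P-congˡ : ∀ p {q q′} → q ≈P q′ → p *P q ≈P p *P q′
  *P-congˡ p {q} {q′} q≈q′ u =
    trans (coeff-*P p q u) (trans (⟪⟫-cong p λ v _ → ⟪⟫-resp-≈P (λ w → δₘ (madd vs v w) u) {q} {q′} q≈q′)
                                  (sym (coeff-*P p q′ u)))

  *P-zeroʳ : ∀ p → p *P 0P ≈P 0P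
  *P-zeroʳ p u = trans (coeff-*P p 0P u) (∑-zero p λ (a , v) _ → zeroʳ a)

  SumIs-agree-at : ∀ {f f′ s} m → SumIs f s → SumIs f′ s →
                   (∀ n → n ≢ m → f n ≈P f′ n) → f m ≈P f′ m
  SumIs-agree-at {f} {f′} {s} m (S , !S , f≈0 , ∑f≈s) (S′ , !S′ , f′≈0 , ∑f′≈s) f≈f′ u =
    ∑-cancel-at m !T m∈T (λ n n≢m → f≈f′ n n≢m u) (begin
      ∑[ n ← T ] coeff (f n) u   ≈⟨ ∑-support (meq vs) _ !S !T (λ n n∉S → f≈0 n n∉S u)
                                                    (vanishes-off-T f S-⊆-T f≈0) ⟨
      ∑[ n ← S ] coeff (f n) u   ≈⟨ coeff-sumP f S u ⟨
      coeff (sumP (List.map f S)) u    ≈⟨ trans (∑f≈s u) (sym (∑f′≈s u)) ⟩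
      coeff (sumP (List.map f′ S′)) u  ≈⟨ coeff-sumP f′ S′ u ⟩
      ∑[ n ← S′ ] coeff (f′ n) u ≈⟨ ∑-support (meq vs) _ !S′ !T (λ n n∉S′ → f′≈0 n n∉S′ u)
                                                    (vanishes-off-T f′ S′-⊆-T f′≈0) ⟩
      ∑[ n ← T ] coeff (f′ n) u  ∎)
    where
    T : List (Mono vs)
    T = deduplicate (meq vs) (m ∷ S ++ S′)
    !T : Unique T
    !T = deduplicate-! (meq vs) (m ∷ S ++ S′)
    m∈T : m ∈ T
    m∈T = ∈-deduplicate⁺ (meq vs) {m ∷ S ++ S′} (here ≡.refl)
    S-⊆-T : ∀ {n} → n ∈ S → n ∈ T
    S-⊆-T = ∈-deduplicate⁺ (meq vs) {m ∷ S ++ S′} ∘ there ∘ ∈-++⁺ˡ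
    S′-⊆-T : ∀ {n} → n ∈ S′ → n ∈ T
    S′-⊆-T = ∈-deduplicate⁺ (meq vs) {m ∷ S ++ S′} ∘ there ∘ ∈-++⁺ʳ S
    vanishes-off-T : ∀ g {R} → (∀ {n} → n ∈ R → n ∈ T) → (∀ n → n ∉ R → g n ≈P 0P) →
                     ∀ n → n ∉ T → coeff (g n) u ≈ 0#
    vanishes-off-T g R-⊆-T g≈0 n n∉T = g≈0 n (n∉T ∘ R-⊆-T) u

  ⟪⟫-difference : ∀ p p′ g → ⟪ p +P (- 1#) ·P p′ , g ⟫ ≈ ⟪ p , g ⟫ - ⟪ p′ , g ⟫
  ⟪⟫-difference p p′ g = trans (∑-++ p _ _) (+-congˡ (trans (⟪⟫-·P (- 1#) p′ g) (-1*x≈-x _)))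
    where open import Algebra.Properties.Ring ring using (-1*x≈-x)

  module Cancellation (laws : MultiIndexLaws vs) where
    open MultiIndexLaws laws
    open MultiIndexProperties laws
    open import Algebra.Properties.Ring ring using (x∙y⁻¹≈ε⇒x≈y; x≈y⇒x∙y⁻¹≈ε)

    unitriangular-kernel : (G : Mono vs → Mono vs → Carrier) → (∀ u → G u u ≈ 1#) →
                           (∀ {u v} → v ≢ u → deg u ℕ.≤ deg v → G v u ≈ 0#) →
                           ∀ (d : Mono vs → Carrier) {V} → Unique V → (∀ v → v ∉ V → d v ≈ 0#) →
                           (∀ u → ∑[ v ← V ] (d v * G v u) ≈ 0#) → ∀ u → d u ≈ 0#
    unitriangular-kernel G G-diag G-upper d {V} !V d≈0 ∑≈0 = deg-induction _ λ u d<≈0 → begin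
      d u              ≈⟨ *-identityʳ _ ⟨
      d u * 1#         ≈⟨ *-congˡ (G-diag u) ⟨
      d u * G u u      ≈⟨ ∑-single (meq vs) u !V (λ v v≢u → lower-vanishes u v v≢u d<≈0)
                                                 (λ u∉V → trans (*-congʳ (d≈0 u u∉V)) (zeroˡ _)) ⟨
      ∑[ v ← V ] (d v * G v u)  ≈⟨ ∑≈0 u ⟩
      0#               ∎
      where
      lower-vanishes : ∀ u v → v ≢ u → (∀ n → deg n ℕ.< deg u → d n ≈ 0#) → d v * G v u ≈ 0#
      lower-vanishes u v v≢u d<≈0 with deg v ℕP.<? deg u
      ... | yes v<u = trans (*-congʳ (d<≈0 v v<u)) (zeroˡ _)
      ... | no  v≮u = trans (*-congˡ (G-upper v≢u (ℕP.≮⇒≥ v≮u))) (zeroʳ _)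

    shiftCoeff-diag : ∀ q u → shiftCoeff q u u ≈ coeff q (mzero vs)
    shiftCoeff-diag q u =
      trans (⟪⟫-cong q λ w _ → δ-cong (meq vs) u+w≡u⇒w≡0 λ { ≡.refl → madd-identityʳ u })
            (sym (coeff≈⟪⟫ q (mzero vs)))
      where
      u+w≡u⇒w≡0 : ∀ {w} → madd vs u w ≡ u → w ≡ mzero vs
      u+w≡u⇒w≡0 {w} eq = madd-deg≤⇒≡mzero u w (ℕP.≤-reflexive (≡.cong deg eq))

    shiftCoeff-upper : ∀ q {u v} → v ≢ u → deg u ℕ.≤ deg v → shiftCoeff q v u ≈ 0#
    shiftCoeff-upper q {u} {v} v≢u u≤v =
      ∑-zero q λ (a , w) _ → trans (*-congˡ (δ-≢ (meq vs) (v+w≢u w))) (zeroʳ a)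
      where
      v+w≢u : ∀ w → madd vs v w ≢ u
      v+w≢u w eq with madd-deg≤⇒≡mzero v w (ℕP.≤-trans (ℕP.≤-reflexive (≡.cong deg eq)) u≤v)
      ... | ≡.refl = v≢u (≡.trans (≡.sym (madd-identityʳ v)) eq)

    *P-cancelʳ : ∀ {p p′} q → coeff q (mzero vs) ≈ 1# → p *P q ≈P p′ *P q → p ≈P p′
    *P-cancelʳ {p} {p′} q q₀≈1 pq≈p′q u = x∙y⁻¹≈ε⇒x≈y _ _ (begin
      coeff p u - coeff p′ u  ≈⟨ -‿+-cong (coeff≈⟪⟫ p u) (coeff≈⟪⟫ p′ u) ⟩
      ⟪ p , δᵤ ⟫ - ⟪ p′ , δᵤ ⟫  ≈⟨ ⟪⟫-difference p p′ δᵤ ⟨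
      ⟪ r , δᵤ ⟫               ≈⟨ coeff≈⟪⟫ r u ⟨
      coeff r u               ≈⟨ r≈0 u ⟩
      0#                      ∎)
      where
      δᵤ : Mono vs → Carrier
      δᵤ v = δₘ v u
      -‿+-cong : ∀ {x x′ y y′} → x ≈ x′ → y ≈ y′ → x - y ≈ x′ - y′
      -‿+-cong x≈x′ y≈y′ = +-cong x≈x′ (-‿cong y≈y′)
      r : Poly
      r = p +P (- 1#) ·P p′
      V : List (Mono vs)
      V = deduplicate (meq vs) (monomials r)
      !V : Unique V
      !V = deduplicate-! (meq vs) (monomials r)
      r⊆V : ∀ {v} → v ∈ monomials r → v ∈ V
      r⊆V = ∈-deduplicate⁺ (meq vs)
      r-kernel : ∀ u → ∑[ v ← V ] (coeff r v * shiftCoeff q v u) ≈ 0#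
      r-kernel u = begin
        ∑[ v ← V ] (coeff r v * shiftCoeff q v u)          ≈⟨ ⟪⟫≈∑-coeff r _ !V (λ _ → r⊆V) ⟨
        ⟪ r , (λ v → shiftCoeff q v u) ⟫                    ≈⟨ ⟪⟫-difference p p′ _ ⟩
        ⟪ p , (λ v → shiftCoeff q v u) ⟫ - ⟪ p′ , (λ v → shiftCoeff q v u) ⟫
                                                           ≈⟨ -‿+-cong (coeff-*P p q u) (coeff-*P p′ q u) ⟨
        coeff (p *P q) u - coeff (p′ *P q) u               ≈⟨ x≈y⇒x∙y⁻¹≈ε (pq≈p′q u) ⟩
        0#                                                 ∎
      r≈0 : ∀ u → coeff r u ≈ 0#
      r≈0 = unitriangular-kernel (shiftCoeff q) (λ u → trans (shiftCoeff-diag q u) q₀≈1) (shiftCoeff-upper q)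
              (coeff r) !V (λ v v∉V → coeff-∉ r v (v∉V ∘ r⊆V)) r-kernel

module ShiftOperators {c ℓ} (K : CommutativeRing c ℓ) {vs : VarSpec} (laws : MultiIndexLaws vs) where
  open CommutativeRing K
  open PolyDefs K vs
  open Polynomials K vs
  open Cancellation laws
  open MultiIndexLaws laws
  open MultiIndexProperties laws
  open import Algebra.Properties.Ring ring using (x+x≈x⇒x≈0)

  module _ (b : Mono vs → Poly) (B : Var vs → Poly → Poly) (B-linear : ∀ i → IsLinear (B i))
           (B-b : ∀ i n → B i (b n) ≈P bShift b i n) where

    b? : Maybe (Mono vs) → Poly
    b? nothing  = 0P
    b? (just k) = b k

    B-zero : ∀ i → B i 0P ≈P 0P
    B-zero i u = x+x≈x⇒x≈0 _ (sym (trans (proj₁ (proj₂ (B-linear i)) 0P 0P u) (coeff-+P (B i 0P) (B i 0P) u)))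

    B-b? : ∀ i k → B i (b? k) ≈P b? (k >>= mdec vs i)
    B-b? i nothing  = B-zero i
    B-b? i (just k) u = trans (B-b i k u) (bShift≈b? u)
      where
      bShift≈b? : bShift b i k ≈P b? (mdec vs i k)
      bShift≈b? with mdec vs i k
      ... | just _  = λ _ → refl
      ... | nothing = λ _ → refl

    foldr-B-b : ∀ is m → List.foldr B (b m) is ≈P b? (mdecs is m)
    foldr-B-b []       m u = refl
    foldr-B-b (i ∷ is) m u = trans (proj₁ (B-linear i) _ _ (foldr-B-b is m) u) (B-b? i (mdecs is m) u)

    summand-diag : ∀ (a : Mono vs → Poly) m → a m *P Bpow B m (b m) ≈P a m *P b (mzero vs)
    summand-diag a m with mdecs (mvars vs m) m | mdecs-mvars-self m | foldr-B-b (mvars vs m) m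
    ... | _ | ≡.refl | Bᵐbₘ≈b₀ = *P-congˡ (a m) Bᵐbₘ≈b₀

    summand-upper : ∀ (a : Mono vs → Poly) {n m} → n ≢ m → deg m ℕ.≤ deg n → a n *P Bpow B n (b m) ≈P 0P
    summand-upper a {n} {m} n≢m m≤n with mdecs (mvars vs n) m in eq | foldr-B-b (mvars vs n) m
    ... | nothing | Bⁿbₘ≈0 = λ u → trans (*P-congˡ (a n) Bⁿbₘ≈0 u) (*P-zeroʳ (a n) u)
    ... | just k  | _      = contradiction (mdecs-mvars-deg≤⇒≡ n m k eq m≤n) n≢m

    coefficients-unique : coeff (b (mzero vs)) (mzero vs) ≈ 1# → (a a′ : Mono vs → Poly) →
                          (∀ m → ∃ λ s → OpSumAt a B (b m) s × OpSumAt a′ B (b m) s) → ∀ n → a n ≈P a′ n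
    coefficients-unique b₀≈1 a a′ same = deg-induction _ step
      where
      step : ∀ m → (∀ n → deg n ℕ.< deg m → a n ≈P a′ n) → a m ≈P a′ m
      step m a≈a′-below with same m
      ... | s , Σa , Σa′ = *P-cancelʳ {a m} {a′ m} (b (mzero vs)) b₀≈1 λ u →
        trans (sym (summand-diag a m u)) (trans (SumIs-agree-at {s = s} m Σa Σa′ agree-off-m u) (summand-diag a′ m u))
        where
        agree-off-m : ∀ n → n ≢ m → a n *P Bpow B n (b m) ≈P a′ n *P Bpow B n (b m)
        agree-off-m n n≢m with deg n ℕP.<? deg m
        ... | yes n<m = *P-congʳ {a n} {a′ n} _ (a≈a′-below n n<m)
        ... | no  n≮m = λ u → trans (summand-upper a n≢m (ℕP.≮⇒≥ n≮m) u)
                                    (sym (summand-upper a′ n≢m (ℕP.≮⇒≥ n≮m) u))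

mainTheorem2 : ∀ {c ℓ} (K : CommutativeRing c ℓ) → IsField K → CharZero K → (vs : VarSpec) →
    let open CommutativeRing K using (_≈_)
        open PolyDefs K vs
    in (b : Mono vs → Poly) → IsBasis b → (∀ n → eval0 (b n) ≈ δ0 n) →
       (B : Var vs → Poly → Poly) → (∀ i → IsLinear (B i)) →
       (∀ i n → B i (b n) ≈P bShift b i n) →
       ((a : Mono vs → Poly) → (∀ p → OpSumAt a B p 0P) → ∀ n → a n ≈P 0P)
       × ((Q : Poly → Poly) → IsLinear Q → (a a′ : Mono vs → Poly) →
          (∀ p → OpSumAt a B p (Q p)) → (∀ p → OpSumAt a′ B p (Q p)) →
          ∀ n → a n ≈P a′ n)
mainTheorem2 K _ _ vs b _ b[0]≈δ0 B B-linear B-b =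
  (λ a Σa≈0 → unique a (λ _ → 0P) λ m → 0P , Σa≈0 (b m) , zero-sum m) ,
  (λ Q _ a a′ Σa≈Q Σa′≈Q → unique a a′ λ m → Q (b m) , Σa≈Q (b m) , Σa′≈Q (b m))
  where
  open CommutativeRing K
  open PolyDefs K vs
  open ShiftOperators K (multiIndexLaws vs)

  b₀[0]≈1 : coeff (b (mzero vs)) (mzero vs) ≈ 1#
  b₀[0]≈1 with b[0]≈δ0 (mzero vs)
  ... | b₀[0]≈δ0 with meq vs (mzero vs) (mzero vs)
  ...   | yes _  = b₀[0]≈δ0
  ...   | no 0≢0 = contradiction ≡.refl 0≢0

  unique : (a a′ : Mono vs → Poly) → (∀ m → ∃ λ s → OpSumAt a B (b m) s × OpSumAt a′ B (b m) s) →
           ∀ n → a n ≈P a′ n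
  unique = coefficients-unique b B B-linear B-b b₀[0]≈1

  zero-sum : ∀ m → OpSumAt (λ _ → 0P) B (b m) 0P
  zero-sum _ = [] , [] , (λ _ _ _ → refl) , λ _ → refl
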